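{- Let $t \ge 3$ and $n \ge 3$ be integers with $n \ne 4$, and let $W_n = C_n + K_1$ be the wheel. Then $M_t(W_n)$ is not a distance magic graph.
   Context: $C_n + K_1$ denotes the join of the cycle $C_n$ with a single vertex (the central vertex), i.e. the wheel with $n$ rim vertices. For a graph $G=(V,E)$ and an integer $t \ge 1$, the generalised Mycielskian $M_t(G)$ is the graph with vertex set $(V \times \{0,1,\dots,t-1\}) \cup \{u\}$ (where $u$ is a new vertex), whose edges are: $(x,0)(y,0)$ for every edge $xy \in E$; $(x,i)(y,i+1)$ for every $0 \le i \le t-2$ and every ordered pair $(x,y)$ with $xy \in E$; and $(x,t-1)u$ for every $x \in V$. A graph $H$ on $N$ vertices is distance magic if there is a bijection $f: V(H) \to \{1,2,\dots,N\}$ and a constant $k$ such that for every vertex $v$, $\sum_{w \in N(v)} f(w) = k$, where $N(v)$ is the open neighbourhood of $v$. -}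

module Defs where

open import Data.Nat using (ℕ; zero; suc; _+_; _*_)
open import Data.Nat.Properties using (_≟_)
open import Data.Bool using (Bool; true; false; _∧_; _∨_; if_then_else_)
open import Data.Fin using (Fin; zero; suc; toℕ; remQuot)
open import Data.Fin.Properties using () renaming (_≟_ to _≟ᶠ_)
open import Data.Product using (Σ; ∃; _,_; _×_)
open import Data.List using (List; map; filter)
open import Data.Nat.ListAction using (sum)
open import Data.List using (allFin) public
open import Function.Bundles using (Bijection)
open import Relation.Binary.PropositionalEquality using (_≡_; setoid)
open import Relation.Nullary.Decidable using (⌊_⌋)

-- A finite graph on vertex set Fin N, given by a Boolean adjacency relation.
-- (The concrete graphs below are symmetric and loopless by construction.)
record Graph : Set where
  constructor mkGraph
  field
    N   : ℕ
    adj : Fin N → Fin N → Bool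
open Graph public

nbhdSum : (G : Graph) → (Fin (N G) → ℕ) → Fin (N G) → ℕ
nbhdSum G f v = sum (map (λ w → if adj G v w then f w else 0) (allFin (N G)))

-- Distance magic: a bijection f : V → {1,…,N} (encoded as Fin N, label = toℕ + 1)
-- and a constant k with Σ_{w ∈ N(v)} f(w) = k for every vertex v.
DistanceMagic : Graph → Set
DistanceMagic G =
  Σ (Bijection (setoid (Fin (N G))) (setoid (Fin (N G)))) λ f →
  Σ ℕ λ k → ∀ v → nbhdSum G (λ w → suc (toℕ (Bijection.to f w))) v ≡ k

_==_ : ℕ → ℕ → Bool
a == b = ⌊ a ≟ b ⌋

-- Wheel W_n = C_n + K_1 on Fin (suc n): vertex zero is the centre,
-- vertices suc i (i : Fin n) are the rim, with suc i ~ suc j iff j ≡ i ± 1 (mod n).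
-- (For n ≥ 3 this is the cycle C_n.)
cycAdj : (n : ℕ) → Fin n → Fin n → Bool
cycAdj n i j =
  ((suc (toℕ i) == toℕ j) ∨ (suc (toℕ j) == toℕ i)
   ∨ ((suc (toℕ i) == n) ∧ (toℕ j == 0))
   ∨ ((suc (toℕ j) == n) ∧ (toℕ i == 0)))
  ∧ (Data.Bool.not ⌊ i ≟ᶠ j ⌋)

wheelAdj : (n : ℕ) → Fin (suc n) → Fin (suc n) → Bool
wheelAdj n zero    zero    = false
wheelAdj n zero    (suc j) = true
wheelAdj n (suc i) zero    = true
wheelAdj n (suc i) (suc j) = cycAdj n i j

-- Generalised Mycielskian M_t(G) on Fin (suc (t * N)): zero is the apex u;
-- suc p with remQuot p = (i , x) is the vertex (x , i), x ∈ V(G), i ∈ {0..t-1}.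
data MVert (t m : ℕ) : Set where
  apex  : MVert t m
  layer : Fin t → Fin m → MVert t m

decodeM : (t m : ℕ) → Fin (suc (t * m)) → MVert t m
decodeM t m zero    = apex
decodeM t m (suc p) with remQuot {t} m p
... | (i , x) = layer i x

myAdjV : (t m : ℕ) → (Fin m → Fin m → Bool) → MVert t m → MVert t m → Bool
myAdjV t m a apex        apex        = false
myAdjV t m a apex        (layer j y) = suc (toℕ j) == t
myAdjV t m a (layer i x) apex        = suc (toℕ i) == t
myAdjV t m a (layer i x) (layer j y) =
  a x y ∧ (((toℕ i == 0) ∧ (toℕ j == 0))
           ∨ (suc (toℕ i) == toℕ j) ∨ (suc (toℕ j) == toℕ i))

myAdj : (t : ℕ) → (G : Graph) → Fin (suc (t * N G)) → Fin (suc (t * N G)) → Bool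
myAdj t G p q = myAdjV t (N G) (adj G) (decodeM t (N G) p) (decodeM t (N G) q)

Wheel : ℕ → Graph
Wheel n = mkGraph (suc n) (wheelAdj n)

Mycielskian : ℕ → Graph → Graph
Mycielskian t G = mkGraph (suc (t * N G)) (myAdj t G)

-- If the neighbourhoods of two vertices x₁, x₂ differ only by exchanging a for b,
-- then equating their neighbourhood sums forces f a = f b, so no labelling is
-- injective. In M_t(G) the copies of x₁, x₂ in the top layer are adjacent only to
-- the apex and to the copies of their G-neighbours in the layer below, so such a
-- pair in G lifts to M_t(G); and the wheel W_n has one for n = 3 and for n ≥ 5.
module Submission where

open import Defs
open import Data.Nat using (ℕ; _≤_)
open import Relation.Binary.PropositionalEquality using (_≢_)
open import Relation.Nullary using (¬_)

open import Data.Bool using (Bool; true; false; _∧_; _∨_; if_then_else_)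
open import Data.Bool.Properties using (∧-zeroʳ; ∧-identityʳ)
open import Data.Fin using (Fin; zero; suc; toℕ; combine; fromℕ; inject₁)
open import Data.Fin.Patterns using (0F; 1F; 2F; 3F; 4F; 5F)
open import Data.Fin.Properties
  using (toℕ<n; toℕ-fromℕ; toℕ-inject₁; toℕ-injective; combine-injectiveʳ; combine-remQuot; remQuot-combine)
  renaming (_≟_ to _≟ᶠ_)
import Data.Fin.Properties as Finₚ
open import Data.List using (map; tabulate)
open import Data.List.Properties using (map-tabulate)
open import Data.Nat using (zero; suc; _+_; _*_; _<_; s≤s)
open import Data.Nat.ListAction using (sum)
open import Data.Nat.Properties
  using (_≟_; +-identityʳ; +-cancelˡ-≡; suc-injective; <⇒≢; +-0-commutativeMonoid)
open import Data.Product using (_,_; uncurry)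
open import Data.Empty using (⊥-elim)
open import Function using (_∘_; id)
open import Function.Bundles using (Bijection)
open import Relation.Binary.PropositionalEquality
  using (_≡_; refl; sym; trans; cong; cong₂; subst; module ≡-Reasoning)
open import Relation.Nullary using (does; yes; no)
open import Relation.Nullary.Decidable using (dec-true; dec-false; isYes≗does)

open import Algebra.Properties.CommutativeMonoid.Sum +-0-commutativeMonoid
  using (∑-distrib-+; sum-cong-≗; sum-replicate-zero) renaming (sum to ∑)

sum-map-allFin : ∀ {n} (g : Fin n → ℕ) → sum (map g (allFin n)) ≡ ∑ g
sum-map-allFin g = trans (cong sum (map-tabulate id g)) (sum-tabulate g)
  where
  sum-tabulate : ∀ {n} (g : Fin n → ℕ) → sum (tabulate g) ≡ ∑ g
  sum-tabulate {zero}  g = refl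
  sum-tabulate {suc n} g = cong (g zero +_) (sum-tabulate (g ∘ suc))

indicator : ∀ {n} → Fin n → ℕ → Fin n → ℕ
indicator b c w = if does (w ≟ᶠ b) then c else 0

∑-indicator : ∀ {n} (b : Fin n) (c : ℕ) → ∑ (indicator b c) ≡ c
∑-indicator {suc n} zero    c = trans (cong (c +_) (sum-replicate-zero n)) (+-identityʳ c)
∑-indicator {suc n} (suc b) c = ∑-indicator b c

record NeighbourhoodSwap (G : Graph) (x₁ x₂ a b : Fin (N G)) : Set where
  field
    a≢b       : a ≢ b
    x₁~a      : adj G x₁ a ≡ true
    x₂≁a      : adj G x₂ a ≡ false
    x₁≁b      : adj G x₁ b ≡ false
    x₂~b      : adj G x₂ b ≡ true
    elsewhere : ∀ w → w ≢ a → w ≢ b → adj G x₁ w ≡ adj G x₂ w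

module _ {G : Graph} {x₁ x₂ a b : Fin (N G)} (swap : NeighbourhoodSwap G x₁ x₂ a b) where
  open NeighbourhoodSwap swap

  nbhdSum-swap : (f : Fin (N G) → ℕ) → nbhdSum G f x₁ + f b ≡ nbhdSum G f x₂ + f a
  nbhdSum-swap f = begin
    nbhdSum G f x₁ + f b
      ≡⟨ cong₂ _+_ (sum-map-allFin (term x₁)) (sym (∑-indicator b (f b))) ⟩
    ∑ (term x₁) + ∑ (indicator b (f b))
      ≡⟨ sym (∑-distrib-+ (term x₁) (indicator b (f b))) ⟩
    ∑ (λ w → term x₁ w + indicator b (f b) w)
      ≡⟨ sum-cong-≗ pointwise ⟩
    ∑ (λ w → term x₂ w + indicator a (f a) w)
      ≡⟨ ∑-distrib-+ (term x₂) (indicator a (f a)) ⟩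
    ∑ (term x₂) + ∑ (indicator a (f a))
      ≡⟨ cong₂ _+_ (sym (sum-map-allFin (term x₂))) (∑-indicator a (f a)) ⟩
    nbhdSum G f x₂ + f a
      ∎
    where
    open ≡-Reasoning
    term : Fin (N G) → Fin (N G) → ℕ
    term v w = if adj G v w then f w else 0
    pointwise : ∀ w → term x₁ w + indicator b (f b) w ≡ term x₂ w + indicator a (f a) w
    pointwise w with w ≟ᶠ a | w ≟ᶠ b
    ... | yes refl | yes a≡b  = ⊥-elim (a≢b a≡b)
    ... | yes refl | no _     rewrite x₁~a | x₂≁a = +-identityʳ (f a)
    ... | no _     | yes refl rewrite x₁≁b | x₂~b = sym (+-identityʳ (f b))
    ... | no w≢a   | no w≢b   rewrite elsewhere w w≢a w≢b = refl

  swap⇒¬DistanceMagic : ¬ DistanceMagic G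
  swap⇒¬DistanceMagic (f , k , magic) = a≢b (Bijection.injective f (toℕ-injective (suc-injective label-a≡label-b)))
    where
    label : Fin (N G) → ℕ
    label w = suc (toℕ (Bijection.to f w))
    label-a≡label-b : label a ≡ label b
    label-a≡label-b = +-cancelˡ-≡ k (label a) (label b) (begin
      k + label a                   ≡⟨ cong (_+ label a) (sym (magic x₂)) ⟩
      nbhdSum G label x₂ + label a  ≡⟨ sym (nbhdSum-swap label) ⟩
      nbhdSum G label x₁ + label b  ≡⟨ cong (_+ label b) (magic x₁) ⟩
      k + label b                   ∎)
      where open ≡-Reasoning

vertex : ∀ {t m} → Fin t → Fin m → Fin (suc (t * m))
vertex i x = suc (combine i x)

data Position (t m : ℕ) : Fin (suc (t * m)) → Set where
  at-apex  : Position t m zero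
  at-layer : (i : Fin t) (x : Fin m) → Position t m (vertex i x)

position : ∀ t m (p : Fin (suc (t * m))) → Position t m p
position t m zero    = at-apex
position t m (suc p) = subst (Position t m ∘ suc) (combine-remQuot {t} m p) (at-layer _ _)

decodeM-vertex : ∀ t m (i : Fin t) (x : Fin m) → decodeM t m (vertex i x) ≡ layer i x
decodeM-vertex t m i x = cong (uncurry layer) (remQuot-combine i x)

layersJoined : ℕ → ℕ → Bool
layersJoined i j = ((i == 0) ∧ (j == 0)) ∨ (suc i == j) ∨ (suc j == i)

module _ (t : ℕ) (G : Graph) where
  adj-vertex : ∀ i j x y →
    adj (Mycielskian t G) (vertex i x) (vertex j y) ≡ adj G x y ∧ layersJoined (toℕ i) (toℕ j)
  adj-vertex i j x y = cong₂ (myAdjV t (N G) (adj G)) (decodeM-vertex t (N G) i x) (decodeM-vertex t (N G) j y)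

  adj-vertex-apex : ∀ i x → adj (Mycielskian t G) (vertex i x) zero ≡ (suc (toℕ i) == t)
  adj-vertex-apex i x = cong (λ v → myAdjV t (N G) (adj G) v apex) (decodeM-vertex t (N G) i x)

layersJoined-suc : ∀ r m → m < 2 + r → layersJoined (suc r) m ≡ does (m ≟ r)
layersJoined-suc r m m<2+r = cong₂ _∨_
  (trans (isYes≗does (2 + r ≟ m)) (dec-false (2 + r ≟ m) (<⇒≢ m<2+r ∘ sym)))
  (isYes≗does (suc m ≟ suc r))

does-toℕ-≟ : ∀ {n} (i j : Fin n) → does (toℕ i ≟ toℕ j) ≡ does (i ≟ᶠ j)
does-toℕ-≟ i j with i ≟ᶠ j
... | yes refl = dec-true (toℕ i ≟ toℕ i) refl
... | no i≢j   = dec-false (toℕ i ≟ toℕ j) (i≢j ∘ toℕ-injective)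

topLayer penultimateLayer : ∀ s → Fin (2 + s)
topLayer s         = fromℕ (suc s)
penultimateLayer s = inject₁ (fromℕ s)

layersJoined-top : ∀ s (k : Fin (2 + s)) →
  layersJoined (toℕ (topLayer s)) (toℕ k) ≡ does (k ≟ᶠ penultimateLayer s)
layersJoined-top s k = begin
  layersJoined (suc (toℕ (fromℕ s))) (toℕ k)  ≡⟨ cong (λ r → layersJoined (suc r) (toℕ k)) (toℕ-fromℕ s) ⟩
  layersJoined (suc s) (toℕ k)                ≡⟨ layersJoined-suc s (toℕ k) (toℕ<n k) ⟩
  does (toℕ k ≟ s)                            ≡⟨ cong (does ∘ (toℕ k ≟_)) (sym toℕ-penultimate) ⟩
  does (toℕ k ≟ toℕ (penultimateLayer s))     ≡⟨ does-toℕ-≟ k (penultimateLayer s) ⟩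
  does (k ≟ᶠ penultimateLayer s)              ∎
  where
  open ≡-Reasoning
  toℕ-penultimate : toℕ (penultimateLayer s) ≡ s
  toℕ-penultimate = trans (toℕ-inject₁ (fromℕ s)) (toℕ-fromℕ s)

mycielskian-swap : ∀ {G x₁ x₂ a b} s → NeighbourhoodSwap G x₁ x₂ a b →
  NeighbourhoodSwap (Mycielskian (2 + s) G)
    (vertex (topLayer s) x₁) (vertex (topLayer s) x₂)
    (vertex (penultimateLayer s) a) (vertex (penultimateLayer s) b)
mycielskian-swap {G} {x₁} {x₂} {a} {b} s swap = record
  { a≢b       = a≢b ∘ combine-injectiveʳ p a p b ∘ Finₚ.suc-injective
  ; x₁~a      = to-penultimate x₁ a x₁~a
  ; x₂≁a      = to-penultimate x₂ a x₂≁a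
  ; x₁≁b      = to-penultimate x₁ b x₁≁b
  ; x₂~b      = to-penultimate x₂ b x₂~b
  ; elsewhere = λ w → agree w (position (2 + s) (N G) w)
  }
  where
  open NeighbourhoodSwap swap
  t : ℕ
  t = 2 + s
  p : Fin t
  p = penultimateLayer s
  G′ : Graph
  G′ = Mycielskian t G

  adj-top : ∀ x k y → adj G′ (vertex (topLayer s) x) (vertex k y) ≡ adj G x y ∧ does (k ≟ᶠ p)
  adj-top x k y = trans (adj-vertex t G (topLayer s) k x y) (cong (adj G x y ∧_) (layersJoined-top s k))

  to-penultimate : ∀ {β} x y → adj G x y ≡ β → adj G′ (vertex (topLayer s) x) (vertex p y) ≡ β
  to-penultimate x y x~y rewrite adj-top x p y | dec-true (p ≟ᶠ p) refl = trans (∧-identityʳ _) x~y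

  agree : ∀ w → Position t (N G) w → w ≢ vertex p a → w ≢ vertex p b →
    adj G′ (vertex (topLayer s) x₁) w ≡ adj G′ (vertex (topLayer s) x₂) w
  agree _ at-apex _ _ = trans (adj-vertex-apex t G (topLayer s) x₁) (sym (adj-vertex-apex t G (topLayer s) x₂))
  agree _ (at-layer k y) w≢a w≢b rewrite adj-top x₁ k y | adj-top x₂ k y with k ≟ᶠ p
  ... | no _     = trans (∧-zeroʳ (adj G x₁ y)) (sym (∧-zeroʳ (adj G x₂ y)))
  ... | yes refl = cong (_∧ true) (elsewhere y (w≢a ∘ cong (vertex p)) (w≢b ∘ cong (vertex p)))

-- Wheel vertex suc i is rim vertex i: in W₃ = K₄ rims 0 and 1 have the same closed
-- neighbourhood; for n ≥ 5, N(rim 1) = {centre, rim 0, rim 2} and N(rim 3) = {centre, rim 2, rim 4}.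
wheel₃-swap : NeighbourhoodSwap (Wheel 3) 1F 2F 2F 1F
wheel₃-swap = record
  { a≢b = λ () ; x₁~a = refl ; x₂≁a = refl ; x₁≁b = refl ; x₂~b = refl ; elsewhere = agree }
  where
  agree : ∀ w → w ≢ 2F → w ≢ 1F → wheelAdj 3 1F w ≡ wheelAdj 3 2F w
  agree 0F _   _   = refl
  agree 1F _   w≢1 = ⊥-elim (w≢1 refl)
  agree 2F w≢2 _   = ⊥-elim (w≢2 refl)
  agree 3F _   _   = refl

wheel≥5-swap : ∀ m → NeighbourhoodSwap (Wheel (5 + m)) 2F 4F 1F 5F
wheel≥5-swap m = record
  { a≢b = λ () ; x₁~a = refl ; x₂≁a = refl ; x₁≁b = trans (∧-identityʳ _) (∧-zeroʳ _) ; x₂~b = refl ; elsewhere = agree }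
  where
  agree : ∀ w → w ≢ 1F → w ≢ 5F → wheelAdj (5 + m) 2F w ≡ wheelAdj (5 + m) 4F w
  agree 0F _   _   = refl
  agree 1F w≢1 _   = ⊥-elim (w≢1 refl)
  agree 2F _   _   = refl
  agree 3F _   _   = refl
  agree 4F _   _   = refl
  agree 5F _   w≢5 = ⊥-elim (w≢5 refl)
  agree (suc (suc (suc (suc (suc (suc _)))))) _ _ = refl

lemma2p9 : (t n : ℕ) → 3 ≤ t → 3 ≤ n → n ≢ 4 →
    ¬ DistanceMagic (Mycielskian t (Wheel n))
lemma2p9 (suc (suc s)) 3 _ _ _ = swap⇒¬DistanceMagic (mycielskian-swap s wheel₃-swap)
lemma2p9 (suc (suc s)) 4 _ _ n≢4 = ⊥-elim (n≢4 refl)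
lemma2p9 (suc (suc s)) (suc (suc (suc (suc (suc m))))) _ _ _ =
  swap⇒¬DistanceMagic (mycielskian-swap s (wheel≥5-swap m))
lemma2p9 (suc (suc s)) 0 _ () _
lemma2p9 (suc (suc s)) 1 _ (s≤s ()) _
lemma2p9 (suc (suc s)) 2 _ (s≤s (s≤s ())) _
lemma2p9 0 _ () _ _
lemma2p9 1 _ (s≤s ()) _ _
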